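{- Let $n=k+\ell$ where $k$ and $\ell$ are even positive integers. Then $\mathcal{D}(k)\mathcal{D}(\ell)=\{ab : a\in\mathcal{D}(k),\, b\in\mathcal{D}(\ell)\}\subseteq \mathcal{D}(n)$. In particular, for each positive even integer $n$, $\mathcal{D}(n)\subseteq\mathcal{D}(n+2)$.
   Context: A tournament of order $n$ is a digraph on $\{1,\dots,n\}$ with exactly one of the arcs $ij$, $ji$ for each pair $i\ne j$. Its Seidel matrix $S=[s_{ij}]$ is the $n\times n$ skew-symmetric matrix with zero diagonal, $s_{ij}=1$ if $ij$ is an arc and $s_{ij}=-1$ otherwise. A Seidel matrix of order $n$ is the Seidel matrix of some tournament of order $n$. $\mathcal{D}(n)=\{\sqrt{\det S} : S \text{ a Seidel matrix of order } n\}$. -}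

module Defs where

open import Data.Nat using (ℕ; zero; suc)
open import Data.Fin using (Fin; zero; suc; punchIn; _≟_)
open import Data.Bool using (Bool; true; false; if_then_else_)
open import Data.Integer using (ℤ; +_; -_; _+_; _*_; 0ℤ; 1ℤ; -1ℤ)
open import Data.Product using (Σ; _×_; ∃; _,_)
open import Relation.Binary.PropositionalEquality using (_≡_; _≢_)
open import Relation.Nullary using (yes; no)

record Tournament (n : ℕ) : Set where
  field
    arc       : Fin n → Fin n → Bool
    loopless  : ∀ i → arc i i ≡ false
    exactlyOne : ∀ i j → i ≢ j → arc i j ≢ arc j i

open Tournament public

Matrix : ℕ → Set
Matrix n = Fin n → Fin n → ℤ

seidel : ∀ {n} → Tournament n → Matrix n
seidel T i j with i ≟ j
... | yes _ = 0ℤ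
... | no  _ = if arc T i j then 1ℤ else -1ℤ

∑ : ∀ {n} → (Fin n → ℤ) → ℤ
∑ {zero}  f = 0ℤ
∑ {suc n} f = f zero + ∑ (λ j → f (suc j))

sgn : ∀ {n} → Fin n → ℤ
sgn zero    = 1ℤ
sgn (suc j) = - sgn j

det : ∀ {n} → Matrix n → ℤ
det {zero}  M = 1ℤ
det {suc n} M = ∑ (λ j → sgn j * (M zero j * det (λ r c → M (suc r) (punchIn j c))))

-- a ∈ 𝒟(n)  iff  a = √(det S) for some Seidel matrix S of order n,
-- i.e. a is a natural number with a² = det S.
InD : ℕ → ℕ → Set
InD n a = Σ (Tournament n) (λ T → det (seidel T) ≡ + (a Data.Nat.* a))

{-# OPTIONS --safe #-}
-- Let S ⇒ T be the tournament in which every vertex of S beats every vertex of T. Its Seidel matrix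
-- is [[A, J], [-Jᵀ, B]], where A and B are the Seidel matrices of S and T and J is all ones. After
-- subtracting, in each block row, the first row from the others, the two blocks are coupled only
-- through the two first rows; expanding multilinearly in those rows leaves det A · det B plus a
-- multiple of the determinant of the bordered matrix [[0, -1ᵀ], [1, A]]. That matrix is
-- skew-symmetric, and of odd order when k is even, so it is singular. Hence det (seidel (S ⇒ T)) is
-- (ab)². For the second claim take for T the tournament of order 2, whose Seidel determinant is 1.

module Submission where

open import Defs
import Algebra.Properties.Semiring.Sum as SemiringSum
open import Data.Bool.Base using (Bool; true; false; if_then_else_)
open import Data.Empty using (⊥-elim)
open import Data.Fin.Base using (Fin; zero; suc; punchIn; lift; splitAt; toℕ; fromℕ<; _↑ˡ_; _↑ʳ_)
open import Data.Fin.Properties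
  using (_≟_; suc-injective; ↑ˡ-injective; ↑ʳ-injective; toℕ-fromℕ<; toℕ-injective; toℕ<n)
open import Data.Integer.Base using (ℤ; +_; -[1+_]; -_; 0ℤ; 1ℤ; -1ℤ)
import Data.Integer.Properties as ℤ
open import Data.Integer.Tactic.RingSolver using (solve-∀)
open import Data.Nat.Base as ℕ using (ℕ; zero; suc)
import Data.Nat.Properties as ℕₚ
open import Data.Product.Base using (_,_)
open import Data.Sum.Base using (inj₁; inj₂; [_,_]′)
open import Data.Vec.Functional using (_∷_; _++_; updateAt; transpose)
open import Data.Vec.Functional.Properties
  using (lookup-++ˡ; lookup-++ʳ; ++-cong; updateAt-updates; updateAt-minimal)
open import Function.Base using (_∘_; const)
open import Relation.Binary.PropositionalEquality
open import Relation.Nullary using (yes; no; Dec; ¬_; contradiction)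

private variable
  k l n : ℕ

module Determinant where

  open import Data.Integer.Base using (_+_; _-_; _*_; _^_)
  open import Algebra.Properties.AbelianGroup ℤ.+-0-abelianGroup using (inverseʳ-unique)
  open SemiringSum ℤ.+-*-semiring using (sum; sum-cong-≗; sum-replicate-zero)
    renaming (∑-distrib-+ to sum-distrib-+; *-distribˡ-sum to *-distribˡ-sum)

  ∑≡sum : (f : Fin n → ℤ) → ∑ f ≡ sum f
  ∑≡sum {zero}  f = refl
  ∑≡sum {suc n} f = cong (_+_ (f zero)) (∑≡sum (f ∘ suc))

  ∑-cong : {f g : Fin n → ℤ} → f ≗ g → ∑ f ≡ ∑ g
  ∑-cong {f = f} {g} f≗g rewrite ∑≡sum f | ∑≡sum g = sum-cong-≗ f≗g

  ∑-distrib-+ : (f g : Fin n → ℤ) → ∑ (λ i → f i + g i) ≡ ∑ f + ∑ g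
  ∑-distrib-+ f g rewrite ∑≡sum (λ i → f i + g i) | ∑≡sum f | ∑≡sum g = sum-distrib-+ f g

  *-distribˡ-∑ : (c : ℤ) (f : Fin n → ℤ) → c * ∑ f ≡ ∑ (λ i → c * f i)
  *-distribˡ-∑ c f rewrite ∑≡sum f | ∑≡sum (λ i → c * f i) = *-distribˡ-sum c f

  ∑-zero : {f : Fin n → ℤ} → (∀ i → f i ≡ 0ℤ) → ∑ f ≡ 0ℤ
  ∑-zero {n} {f} f≗0 rewrite ∑≡sum f = trans (sum-cong-≗ f≗0) (sum-replicate-zero n)

  ∑-comm : (f : Fin k → Fin l → ℤ) → ∑ (λ i → ∑ (f i)) ≡ ∑ (λ j → ∑ (λ i → f i j))
  ∑-comm {zero} {l} f = sym (∑-zero {l} (λ _ → refl))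
  ∑-comm {suc k} f =
    trans (cong (_+_ (∑ (f zero))) (∑-comm (f ∘ suc))) (sym (∑-distrib-+ (f zero) _))

  ∑-split : (f : Fin (k ℕ.+ l) → ℤ) → ∑ f ≡ ∑ (f ∘ (_↑ˡ l)) + ∑ (f ∘ (k ↑ʳ_))
  ∑-split {zero}  f = sym (ℤ.+-identityˡ _)
  ∑-split {suc k} {l} f = trans (cong (_+_ (f zero)) (∑-split {k} {l} (f ∘ suc))) (sym (ℤ.+-assoc (f zero) _ _))

  -- Multilinearity in the rows

  minor : Matrix (suc n) → Fin (suc n) → Matrix n
  minor M j r c = M (suc r) (punchIn j c)

  laplaceTerm : Matrix (suc n) → Fin (suc n) → ℤ
  laplaceTerm M j = sgn j * (M zero j * det (minor M j))

  det-cong : {M N : Matrix n} → (∀ i j → M i j ≡ N i j) → det M ≡ det N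
  det-cong {zero}  M≗N = refl
  det-cong {suc n} M≗N = ∑-cong λ j →
    cong₂ (λ x d → sgn j * (x * d)) (M≗N zero j) (det-cong λ r c → M≗N (suc r) (punchIn j c))

  SameRowsExcept : Fin n → Matrix n → Matrix n → Set
  SameRowsExcept p M N = ∀ i → i ≢ p → M i ≗ N i

  minor-sameRowsExcept : {M N : Matrix (suc n)} {p : Fin n} (j : Fin (suc n)) →
                         SameRowsExcept (suc p) M N → SameRowsExcept p (minor M j) (minor N j)
  minor-sameRowsExcept j M~N i i≢p c = M~N (suc i) (i≢p ∘ suc-injective) (punchIn j c)

  det-minor-sameRowsExcept-zero : {M N : Matrix (suc n)} (j : Fin (suc n)) →
                                  SameRowsExcept zero M N → det (minor M j) ≡ det (minor N j)
  det-minor-sameRowsExcept-zero j M~N = det-cong λ r c → M~N (suc r) (λ ()) (punchIn j c)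

  det-row-additive : {M N P : Matrix n} (p : Fin n) → SameRowsExcept p M P → SameRowsExcept p N P →
                     (∀ j → P p j ≡ M p j + N p j) → det P ≡ det M + det N
  det-row-additive {suc n} {M} {N} {P} zero M~P N~P Pₚ =
    trans (∑-cong term) (∑-distrib-+ (laplaceTerm M) (laplaceTerm N))
    where
    term : ∀ j → laplaceTerm P j ≡ laplaceTerm M j + laplaceTerm N j
    term j = begin
      sgn j * (P zero j * det (minor P j))
        ≡⟨ cong (λ x → sgn j * (x * det (minor P j))) (Pₚ j) ⟩
      sgn j * ((M zero j + N zero j) * det (minor P j))
        ≡⟨ distrib (sgn j) (M zero j) (N zero j) (det (minor P j)) ⟩
      sgn j * (M zero j * det (minor P j)) + sgn j * (N zero j * det (minor P j))
        ≡⟨ sym (cong₂ (λ x y → sgn j * (M zero j * x) + sgn j * (N zero j * y))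
                      (det-minor-sameRowsExcept-zero j M~P) (det-minor-sameRowsExcept-zero j N~P)) ⟩
      laplaceTerm M j + laplaceTerm N j ∎
      where
      open ≡-Reasoning
      distrib : ∀ s x y d → s * ((x + y) * d) ≡ s * (x * d) + s * (y * d)
      distrib = solve-∀
  det-row-additive {suc n} {M} {N} {P} (suc p) M~P N~P Pₚ =
    trans (∑-cong term) (∑-distrib-+ (laplaceTerm M) (laplaceTerm N))
    where
    term : ∀ j → laplaceTerm P j ≡ laplaceTerm M j + laplaceTerm N j
    term j = begin
      sgn j * (P zero j * det (minor P j))
        ≡⟨ cong (λ d → sgn j * (P zero j * d))
                (det-row-additive p (minor-sameRowsExcept j M~P) (minor-sameRowsExcept j N~P) (Pₚ ∘ punchIn j)) ⟩
      sgn j * (P zero j * (det (minor M j) + det (minor N j)))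
        ≡⟨ distrib (sgn j) (P zero j) (det (minor M j)) (det (minor N j)) ⟩
      sgn j * (P zero j * det (minor M j)) + sgn j * (P zero j * det (minor N j))
        ≡⟨ sym (cong₂ (λ x y → sgn j * (x * det (minor M j)) + sgn j * (y * det (minor N j)))
                      (M~P zero (λ ()) j) (N~P zero (λ ()) j)) ⟩
      laplaceTerm M j + laplaceTerm N j ∎
      where
      open ≡-Reasoning
      distrib : ∀ s x d e → s * (x * (d + e)) ≡ s * (x * d) + s * (x * e)
      distrib = solve-∀

  det-row-scale : {M N : Matrix n} (p : Fin n) (c : ℤ) → SameRowsExcept p M N →
                  (∀ j → N p j ≡ c * M p j) → det N ≡ c * det M
  det-row-scale {suc n} {M} {N} zero c M~N Nₚ = trans (∑-cong term) (sym (*-distribˡ-∑ c (laplaceTerm M)))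
    where
    term : ∀ j → laplaceTerm N j ≡ c * laplaceTerm M j
    term j = begin
      sgn j * (N zero j * det (minor N j))
        ≡⟨ cong₂ (λ x d → sgn j * (x * d)) (Nₚ j) (sym (det-minor-sameRowsExcept-zero j M~N)) ⟩
      sgn j * ((c * M zero j) * det (minor M j))  ≡⟨ pull (sgn j) c (M zero j) (det (minor M j)) ⟩
      c * laplaceTerm M j ∎
      where
      open ≡-Reasoning
      pull : ∀ s c x d → s * ((c * x) * d) ≡ c * (s * (x * d))
      pull = solve-∀
  det-row-scale {suc n} {M} {N} (suc p) c M~N Nₚ = trans (∑-cong term) (sym (*-distribˡ-∑ c (laplaceTerm M)))
    where
    term : ∀ j → laplaceTerm N j ≡ c * laplaceTerm M j
    term j = begin
      sgn j * (N zero j * det (minor N j))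
        ≡⟨ cong₂ (λ x d → sgn j * (x * d)) (sym (M~N zero (λ ()) j))
                 (det-row-scale p c (minor-sameRowsExcept j M~N) (Nₚ ∘ punchIn j)) ⟩
      sgn j * (M zero j * (c * det (minor M j)))  ≡⟨ pull (sgn j) c (M zero j) (det (minor M j)) ⟩
      c * laplaceTerm M j ∎
      where
      open ≡-Reasoning
      pull : ∀ s c x d → s * (x * (c * d)) ≡ c * (s * (x * d))
      pull = solve-∀

  det-zero-row : (M : Matrix n) (p : Fin n) → (∀ j → M p j ≡ 0ℤ) → det M ≡ 0ℤ
  det-zero-row M p Mₚ≡0 = det-row-scale {M = M} p 0ℤ (λ _ _ _ → refl) Mₚ≡0

  -- Alternation

  _[_]≔_ : Matrix n → Fin n → (Fin n → ℤ) → Matrix n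
  M [ p ]≔ r = updateAt M p (const r)

  []≔-updates : (M : Matrix n) (p : Fin n) (r : Fin n → ℤ) → (M [ p ]≔ r) p ≡ r
  []≔-updates M p r = updateAt-updates p M

  []≔-minimal : (M : Matrix n) {p i : Fin n} (r : Fin n → ℤ) → i ≢ p → (M [ p ]≔ r) i ≡ M i
  []≔-minimal M {p} {i} r i≢p = updateAt-minimal i p M i≢p

  rows-≗ : {M N : Matrix n} {p q : Fin n} → M p ≗ N p → M q ≗ N q →
           (∀ i → i ≢ p → i ≢ q → M i ≗ N i) → ∀ i j → M i j ≡ N i j
  rows-≗ {p = p} {q} Mₚ Mq Mₒ i j with i ≟ p | i ≟ q
  ... | yes refl | _        = Mₚ j
  ... | no _     | yes refl = Mq j
  ... | no i≢p   | no i≢q   = Mₒ i i≢p i≢q j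

  Alternating : ℕ → Set
  Alternating n = (M : Matrix n) {p q : Fin n} → p ≢ q → M p ≗ M q → det M ≡ 0ℤ

  det-swap-rows : Alternating n → {M N : Matrix n} {p q : Fin n} → p ≢ q →
                  N p ≗ M q → N q ≗ M p → (∀ i → i ≢ p → i ≢ q → N i ≗ M i) → det N ≡ - det M
  det-swap-rows {n} alt {M} {N} {p} {q} p≢q Nₚ Nq Nₒ = inverseʳ-unique (det M) (det N) (sym 0≡M+N)
    where
    R : (Fin n → ℤ) → (Fin n → ℤ) → Matrix n
    R x y = (M [ p ]≔ x) [ q ]≔ y
    Rₚ : ∀ x y → R x y p ≡ x
    Rₚ x y = trans ([]≔-minimal (M [ p ]≔ x) y p≢q) ([]≔-updates M p x)
    Rq : ∀ x y → R x y q ≡ y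
    Rq x y = []≔-updates (M [ p ]≔ x) q y
    Rₒ : ∀ x y i → i ≢ p → i ≢ q → R x y i ≡ M i
    Rₒ x y i i≢p i≢q = trans ([]≔-minimal (M [ p ]≔ x) y i≢q) ([]≔-minimal M x i≢p)
    _⊕_ : (Fin n → ℤ) → (Fin n → ℤ) → Fin n → ℤ
    (x ⊕ y) j = x j + y j
    additive-p : ∀ x x′ y → det (R (x ⊕ x′) y) ≡ det (R x y) + det (R x′ y)
    additive-p x x′ y = det-row-additive p (same x) (same x′)
      λ j → cong-app (trans (Rₚ (x ⊕ x′) y) (sym (cong₂ _⊕_ (Rₚ x y) (Rₚ x′ y)))) j
      where
      same : ∀ x″ → SameRowsExcept p (R x″ y) (R (x ⊕ x′) y)
      same x″ i i≢p with i ≟ q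
      ... | yes refl = cong-app (trans (Rq x″ y) (sym (Rq (x ⊕ x′) y)))
      ... | no i≢q   = cong-app (trans (Rₒ x″ y i i≢p i≢q) (sym (Rₒ (x ⊕ x′) y i i≢p i≢q)))
    additive-q : ∀ x y y′ → det (R x (y ⊕ y′)) ≡ det (R x y) + det (R x y′)
    additive-q x y y′ = det-row-additive q (same y) (same y′)
      λ j → cong-app (trans (Rq x (y ⊕ y′)) (sym (cong₂ _⊕_ (Rq x y) (Rq x y′)))) j
      where
      same : ∀ y″ → SameRowsExcept q (R x y″) (R x (y ⊕ y′))
      same y″ i i≢q =
        cong-app (trans ([]≔-minimal (M [ p ]≔ x) y″ i≢q) (sym ([]≔-minimal (M [ p ]≔ x) (y ⊕ y′) i≢q)))
    R-diagonal : ∀ x → det (R x x) ≡ 0ℤ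
    R-diagonal x = alt (R x x) p≢q (cong-app (trans (Rₚ x x) (sym (Rq x x))))
    u v : Fin n → ℤ
    u = M p
    v = M q
    R≗M : ∀ i j → R u v i j ≡ M i j
    R≗M = rows-≗ (cong-app (Rₚ u v)) (cong-app (Rq u v)) λ i i≢p i≢q → cong-app (Rₒ u v i i≢p i≢q)
    R≗N : ∀ i j → R v u i j ≡ N i j
    R≗N = rows-≗ (λ j → trans (cong-app (Rₚ v u) j) (sym (Nₚ j)))
                  (λ j → trans (cong-app (Rq v u) j) (sym (Nq j)))
                  λ i i≢p i≢q j → trans (cong-app (Rₒ v u i i≢p i≢q) j) (sym (Nₒ i i≢p i≢q j))
    0≡M+N : 0ℤ ≡ det M + det N
    0≡M+N = begin
      0ℤ                                                   ≡⟨ sym (R-diagonal (u ⊕ v)) ⟩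
      det (R (u ⊕ v) (u ⊕ v))                              ≡⟨ additive-p u v (u ⊕ v) ⟩
      det (R u (u ⊕ v)) + det (R v (u ⊕ v))                ≡⟨ cong₂ _+_ (additive-q u u v) (additive-q v u v) ⟩
      (det (R u u) + det (R u v)) + (det (R v u) + det (R v v))
        ≡⟨ cong₂ _+_ (cong₂ _+_ (R-diagonal u) (det-cong R≗M)) (cong₂ _+_ (det-cong R≗N) (R-diagonal v)) ⟩
      (0ℤ + det M) + (det N + 0ℤ)
        ≡⟨ cong₂ _+_ (ℤ.+-identityˡ (det M)) (ℤ.+-identityʳ (det N)) ⟩
      det M + det N ∎
      where open ≡-Reasoning

  -- The (c, d) term of the Laplace expansion along the first two rows when both are x; D σ stands for
  -- the determinant of the remaining rows restricted to the columns σ.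
  pairTerm : (Fin (suc (suc n)) → ℤ) → ((Fin n → Fin (suc (suc n))) → ℤ) →
             Fin (suc (suc n)) → Fin (suc n) → ℤ
  pairTerm x D c d = sgn c * sgn d * (x c * x (punchIn c d)) * D (punchIn c ∘ punchIn d)

  lift₁-cong : {σ τ : Fin n → Fin k} → σ ≗ τ → lift 1 σ ≗ lift 1 τ
  lift₁-cong σ≗τ zero    = refl
  lift₁-cong σ≗τ (suc e) = cong suc (σ≗τ e)

  -- The term (c, d) cancels against the term that picks the same two columns in the other order.
  pairs-cancel : (x : Fin (suc (suc n)) → ℤ) (D : (Fin n → Fin (suc (suc n))) → ℤ) →
                 (∀ {σ τ} → σ ≗ τ → D σ ≡ D τ) → ∑ (λ c → ∑ (pairTerm x D c)) ≡ 0ℤ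
  pairs-cancel-suc : (x : Fin (suc (suc n)) → ℤ) (D : (Fin n → Fin (suc (suc n))) → ℤ) →
                     (∀ {σ τ} → σ ≗ τ → D σ ≡ D τ) →
                     ∑ (λ c → ∑ (pairTerm x D (suc c) ∘ suc)) ≡ 0ℤ

  pairs-cancel x D D-cong = begin
    ∑ (T zero) + ∑ (λ c → T (suc c) zero + ∑ (T (suc c) ∘ suc))
      ≡⟨ cong (_+_ (∑ (T zero))) (∑-distrib-+ (λ c → T (suc c) zero) (λ c → ∑ (T (suc c) ∘ suc))) ⟩
    ∑ (T zero) + (∑ (λ c → T (suc c) zero) + ∑ (λ c → ∑ (T (suc c) ∘ suc)))
      ≡⟨ sym (ℤ.+-assoc (∑ (T zero)) _ _) ⟩
    (∑ (T zero) + ∑ (λ c → T (suc c) zero)) + ∑ (λ c → ∑ (T (suc c) ∘ suc))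
      ≡⟨ cong₂ _+_ (trans (sym (∑-distrib-+ (T zero) (λ c → T (suc c) zero))) (∑-zero opposite))
                   (pairs-cancel-suc x D D-cong) ⟩
    0ℤ ∎
    where
    open ≡-Reasoning
    T = pairTerm x D
    cancel : ∀ s a b e → 1ℤ * s * (a * b) * e + (- s) * 1ℤ * (b * a) * e ≡ 0ℤ
    cancel = solve-∀
    opposite : ∀ d → T zero d + T (suc d) zero ≡ 0ℤ
    opposite d = cancel (sgn d) (x zero) (x (suc d)) (D (suc ∘ punchIn d))

  pairs-cancel-suc {zero}  x D D-cong = refl
  pairs-cancel-suc {suc n} x D D-cong =
    trans (∑-cong λ c → ∑-cong λ d → shift c d)
          (pairs-cancel (x ∘ suc) (D ∘ lift 1) (D-cong ∘ lift₁-cong))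
    where
    negate² : ∀ s t a e → (- s) * (- t) * a * e ≡ s * t * a * e
    negate² = solve-∀
    punchIn-suc : ∀ c d → punchIn (suc c) ∘ punchIn (suc d) ≗ lift 1 (punchIn c ∘ punchIn d)
    punchIn-suc c d zero    = refl
    punchIn-suc c d (suc e) = refl
    shift : ∀ c d → pairTerm x D (suc c) (suc d) ≡ pairTerm (x ∘ suc) (D ∘ lift 1) c d
    shift c d = trans (cong (λ e → (- sgn c) * (- sgn d) * (x (suc c) * x (suc (punchIn c d))) * e)
                            (D-cong (punchIn-suc c d)))
                      (negate² (sgn c) (sgn d) _ _)

  det-equal-first-rows : (M : Matrix (suc (suc n))) → M zero ≗ M (suc zero) → det M ≡ 0ℤ
  det-equal-first-rows {n} M M₀≗M₁ = trans (∑-cong expand) (pairs-cancel (M zero) D D-cong)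
    where
    D : (Fin n → Fin (suc (suc n))) → ℤ
    D σ = det (λ r e → M (suc (suc r)) (σ e))
    D-cong : ∀ {σ τ} → σ ≗ τ → D σ ≡ D τ
    D-cong σ≗τ = det-cong λ r e → cong (M (suc (suc r))) (σ≗τ e)
    regroup : ∀ s t a b e → s * a * (t * (b * e)) ≡ s * t * (a * b) * e
    regroup = solve-∀
    expand : ∀ c → laplaceTerm M c ≡ ∑ (pairTerm (M zero) D c)
    expand c = begin
      sgn c * (M zero c * det (minor M c))    ≡⟨ sym (ℤ.*-assoc (sgn c) (M zero c) _) ⟩
      sgn c * M zero c * det (minor M c)      ≡⟨ *-distribˡ-∑ (sgn c * M zero c) (laplaceTerm (minor M c)) ⟩
      ∑ (λ d → sgn c * M zero c * laplaceTerm (minor M c) d)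
        ≡⟨ ∑-cong (λ d → trans (regroup (sgn c) (sgn d) (M zero c) _ _)
                               (cong (λ b → sgn c * sgn d * (M zero c * b) * D (punchIn c ∘ punchIn d))
                                     (sym (M₀≗M₁ (punchIn c d))))) ⟩
      ∑ (pairTerm (M zero) D c) ∎
      where open ≡-Reasoning

  -- Swapping rows 1 and q + 1 inside every minor reduces to the case of equal adjacent rows.
  det-row-zero-equal : Alternating n → (M : Matrix (suc n)) (q : Fin n) → M zero ≗ M (suc q) → det M ≡ 0ℤ
  det-row-zero-equal {suc n} alt M zero    M₀≗M₁ = det-equal-first-rows M M₀≗M₁
  det-row-zero-equal {suc n} alt M (suc q) M₀≗Mq = begin
    det M          ≡⟨ sym (ℤ.neg-involutive (det M)) ⟩
    - - det M      ≡⟨ cong -_ (sym det-swapped) ⟩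
    - det M′       ≡⟨ cong -_ (det-equal-first-rows M′ λ j → trans (M₀≗Mq j) (sym (M′₁ j))) ⟩
    - 0ℤ ∎
    where
    open ≡-Reasoning
    one target : Fin (suc (suc n))
    one    = suc zero
    target = suc (suc q)
    M′ : Matrix (suc (suc n))
    M′ = (M [ one ]≔ M target) [ target ]≔ M one
    M′₁ : M′ one ≗ M target
    M′₁ = cong-app (trans ([]≔-minimal (M [ one ]≔ M target) {target} {one} (M one) λ ())
                          ([]≔-updates M one (M target)))
    M′ₜ : M′ target ≗ M one
    M′ₜ = cong-app ([]≔-updates (M [ one ]≔ M target) target (M one))
    M′ₒ : ∀ i → i ≢ one → i ≢ target → M′ i ≗ M i
    M′ₒ i i≢1 i≢t =
      cong-app (trans ([]≔-minimal (M [ one ]≔ M target) (M one) i≢t) ([]≔-minimal M (M target) i≢1))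
    minor-swapped : ∀ c → det (minor M′ c) ≡ - det (minor M c)
    minor-swapped c = det-swap-rows alt {p = zero} {suc q} (λ ())
      (M′₁ ∘ punchIn c) (M′ₜ ∘ punchIn c)
      λ i i≢0 i≢q e → M′ₒ (suc i) (i≢0 ∘ suc-injective) (i≢q ∘ suc-injective) (punchIn c e)
    negate : ∀ s x d → s * (x * (- d)) ≡ -1ℤ * (s * (x * d))
    negate = solve-∀
    det-swapped : det M′ ≡ - det M
    det-swapped = begin
      ∑ (laplaceTerm M′)
        ≡⟨ ∑-cong (λ c → trans (cong₂ (λ x d → sgn c * (x * d)) (M′ₒ zero (λ ()) (λ ()) c)
                                                                (minor-swapped c))
                               (negate (sgn c) (M zero c) (det (minor M c)))) ⟩
      ∑ (λ c → -1ℤ * laplaceTerm M c)  ≡⟨ sym (*-distribˡ-∑ -1ℤ (laplaceTerm M)) ⟩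
      -1ℤ * det M                      ≡⟨ ℤ.-1*i≡-i (det M) ⟩
      - det M ∎

  alternating-suc : Alternating n → Alternating (suc n)
  alternating-suc alt M {zero}  {zero}  0≢0 _ = ⊥-elim (0≢0 refl)
  alternating-suc alt M {zero}  {suc q} _ M₀≗Mq = det-row-zero-equal alt M q M₀≗Mq
  alternating-suc alt M {suc p} {zero}  _ Mₚ≗M₀ = det-row-zero-equal alt M p (λ j → sym (Mₚ≗M₀ j))
  alternating-suc alt M {suc p} {suc q} p≢q Mₚ≗Mq = ∑-zero λ c →
    trans (cong (λ d → sgn c * (M zero c * d)) (alt (minor M c) (p≢q ∘ cong suc) (Mₚ≗Mq ∘ punchIn c)))
          (vanish (sgn c) (M zero c))
    where
    vanish : ∀ s x → s * (x * 0ℤ) ≡ 0ℤ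
    vanish = solve-∀

  det-alternating : ∀ n → Alternating n
  det-alternating zero    M {()}
  det-alternating (suc n) = alternating-suc (det-alternating n)

  det-add-row-multiple : {M N : Matrix n} {p q : Fin n} (c : ℤ) → q ≢ p →
                         (∀ j → N q j ≡ M q j + c * M p j) → SameRowsExcept q M N → det N ≡ det M
  det-add-row-multiple {n} {M} {N} {p} {q} c q≢p N-row-q M~N = begin
    det N          ≡⟨ det-row-additive q M~N Z~N N-row-q′ ⟩
    det M + det Z  ≡⟨ cong (_+_ (det M)) (det-row-scale q c W~Z Z-row-q) ⟩
    det M + c * det W
      ≡⟨ cong (λ d → det M + c * d)
              (det-alternating n W (q≢p ∘ sym) (cong-app (trans W-row-p (sym W-row-q)))) ⟩
    det M + c * 0ℤ ≡⟨ cong (_+_ (det M)) (ℤ.*-zeroʳ c) ⟩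
    det M + 0ℤ     ≡⟨ ℤ.+-identityʳ (det M) ⟩
    det M ∎
    where
    open ≡-Reasoning
    W Z : Matrix n
    W = M [ q ]≔ M p
    Z = M [ q ]≔ (λ j → c * M p j)
    W-row-p : W p ≡ M p
    W-row-p = []≔-minimal M (M p) (q≢p ∘ sym)
    W-row-q : W q ≡ M p
    W-row-q = []≔-updates M q (M p)
    Z-row-q : ∀ j → Z q j ≡ c * W q j
    Z-row-q j = trans (cong-app ([]≔-updates M q _) j) (cong (c *_) (sym (cong-app W-row-q j)))
    N-row-q′ : ∀ j → N q j ≡ M q j + Z q j
    N-row-q′ j = trans (N-row-q j) (cong (_+_ (M q j)) (sym (cong-app ([]≔-updates M q _) j)))
    Z~N : SameRowsExcept q Z N
    Z~N i i≢q j = trans (cong-app ([]≔-minimal M _ i≢q) j) (M~N i i≢q j)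
    W~Z : SameRowsExcept q W Z
    W~Z i i≢q j = cong-app (trans ([]≔-minimal M (M p) i≢q) (sym ([]≔-minimal M _ i≢q))) j

  -- The operations are applied to the rows in order of index: each step is a single row operation,
  -- and its pivot row is unaffected by all of them.
  module PivotRowOperations {M : Matrix n} (π : Fin n → Fin n) (c : Fin n → ℤ)
                            (pivots-fixed : ∀ i → c (π i) ≡ 0ℤ) where

    mask : ℕ → Fin n → ℤ
    mask m i with toℕ i ℕₚ.<? m
    ... | yes _ = c i
    ... | no  _ = 0ℤ

    mask-below : ∀ {m i} → toℕ i ℕ.< m → mask m i ≡ c i
    mask-below {m} {i} i<m with toℕ i ℕₚ.<? m
    ... | yes _  = refl
    ... | no i≮m = contradiction i<m i≮m

    mask-above : ∀ {m i} → ¬ toℕ i ℕ.< m → mask m i ≡ 0ℤ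
    mask-above {m} {i} i≮m with toℕ i ℕₚ.<? m
    ... | yes i<m = contradiction i<m i≮m
    ... | no  _   = refl

    mask-suc : ∀ {m i} → toℕ i ≢ m → mask (suc m) i ≡ mask m i
    mask-suc {m} {i} i≢m with toℕ i ℕₚ.<? m
    ... | yes i<m = mask-below (ℕₚ.m<n⇒m<1+n i<m)
    ... | no  i≮m = mask-above ([ i≮m , i≢m ]′ ∘ ℕₚ.m<1+n⇒m<n∨m≡n)

    mask-pivot : ∀ m i → mask m (π i) ≡ 0ℤ
    mask-pivot m i with toℕ (π i) ℕₚ.<? m
    ... | yes _ = pivots-fixed i
    ... | no  _ = refl

    operated : ℕ → Matrix n
    operated m i j = M i j + mask m i * M (π i) j

    operated-pivot : ∀ m i → operated m (π i) ≗ M (π i)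
    operated-pivot m i j = trans (cong (λ w → M (π i) j + w * _) (mask-pivot m i)) (ℤ.+-identityʳ _)

    toℕ≢m : ∀ {m} (m<n : m ℕ.< n) {i} → i ≢ fromℕ< m<n → toℕ i ≢ m
    toℕ≢m m<n i≢q i≡m = i≢q (toℕ-injective (trans i≡m (sym (toℕ-fromℕ< m<n))))

    mask-new : ∀ {m} (m<n : m ℕ.< n) → mask (suc m) (fromℕ< m<n) ≡ c (fromℕ< m<n)
    mask-new {m} m<n = mask-below (subst (ℕ._< suc m) (sym (toℕ-fromℕ< m<n)) (ℕₚ.n<1+n m))

    mask-old : ∀ {m} (m<n : m ℕ.< n) → mask m (fromℕ< m<n) ≡ 0ℤ
    mask-old {m} m<n = mask-above (subst (λ x → ¬ x ℕ.< m) (sym (toℕ-fromℕ< m<n)) (ℕₚ.n≮n m))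

    det-operated-suc : ∀ {m} → m ℕ.< n → det (operated (suc m)) ≡ det (operated m)
    det-operated-suc {m} m<n with π (fromℕ< m<n) ≟ fromℕ< m<n
    ... | yes πq≡q = det-cong λ i j → cong (λ w → M i j + w * M (π i) j) (mask-same i)
      where
      q = fromℕ< m<n
      mask-same : ∀ i → mask (suc m) i ≡ mask m i
      mask-same i with i ≟ q
      ... | no  i≢q  = mask-suc (toℕ≢m m<n i≢q)
      ... | yes refl = trans (mask-new m<n) (trans (cong c (sym πq≡q)) (trans (pivots-fixed q) (sym (mask-old m<n))))
    ... | no  πq≢q = det-add-row-multiple (c q) (πq≢q ∘ sym) row-q
                       λ i i≢q j → cong (λ w → M i j + w * M (π i) j) (sym (mask-suc (toℕ≢m m<n i≢q)))
      where
      q = fromℕ< m<n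
      row-q : ∀ j → operated (suc m) q j ≡ operated m q j + c q * operated m (π q) j
      row-q j = begin
        M q j + mask (suc m) q * M (π q) j     ≡⟨ cong (λ w → M q j + w * M (π q) j) (mask-new m<n) ⟩
        M q j + c q * M (π q) j                ≡⟨ cong₂ (λ x y → x + c q * y) (sym (ℤ.+-identityʳ (M q j)))
                                                                             (sym (operated-pivot m q j)) ⟩
        (M q j + 0ℤ) + c q * operated m (π q) j
          ≡⟨ cong (λ w → (M q j + w * M (π q) j) + c q * operated m (π q) j) (sym (mask-old m<n)) ⟩
        operated m q j + c q * operated m (π q) j ∎
        where open ≡-Reasoning

    det-operated : ∀ {m} → m ℕ.≤ n → det (operated m) ≡ det M
    det-operated {zero}  _   = det-cong λ i j → ℤ.+-identityʳ (M i j)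
    det-operated {suc m} m<n = trans (det-operated-suc m<n) (det-operated (ℕₚ.<⇒≤ m<n))

  det-add-pivot-rows : {M N : Matrix n} (π : Fin n → Fin n) (c : Fin n → ℤ) → (∀ i → c (π i) ≡ 0ℤ) →
                       (∀ i j → N i j ≡ M i j + c i * M (π i) j) → det N ≡ det M
  det-add-pivot-rows {n} {M} π c pivots-fixed N≗ = trans
    (det-cong λ i j → trans (N≗ i j) (cong (λ w → M i j + w * M (π i) j) (sym (mask-below (toℕ<n i)))))
    (det-operated ℕₚ.≤-refl)
    where open PivotRowOperations {M = M} π c pivots-fixed

  -- Transposition

  columnTerm : Matrix (suc n) → Fin (suc n) → ℤ
  columnTerm M i = sgn i * (M i zero * det (λ r c → M (punchIn i r) (suc c)))

  det-column-expansion : (M : Matrix (suc n)) → det M ≡ ∑ (columnTerm M)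
  det-column-expansion {zero}  M = refl
  det-column-expansion {suc n} M =
    cong (_+_ (laplaceTerm M zero)) (trans (∑-cong rows) (trans (∑-comm G) (sym (∑-cong columns))))
    where
    D : Fin (suc n) → Fin (suc n) → ℤ
    D i d = det (λ r c → M (suc (punchIn i r)) (suc (punchIn d c)))
    G : Fin (suc n) → Fin (suc n) → ℤ
    G d i = - (sgn d * sgn i * M zero (suc d) * M (suc i) zero * D i d)
    reorder₁ : ∀ s t a b e → ((- s) * a) * (t * (b * e)) ≡ - (s * t * a * b * e)
    reorder₁ = solve-∀
    reorder₂ : ∀ s t a b e → ((- t) * b) * (s * (a * e)) ≡ - (s * t * a * b * e)
    reorder₂ = solve-∀
    rows : ∀ d → laplaceTerm M (suc d) ≡ ∑ (G d)
    rows d = begin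
      (- sgn d) * (M zero (suc d) * det (minor M (suc d)))
        ≡⟨ cong (λ e → (- sgn d) * (M zero (suc d) * e)) (det-column-expansion (minor M (suc d))) ⟩
      (- sgn d) * (M zero (suc d) * ∑ (columnTerm (minor M (suc d))))
        ≡⟨ sym (ℤ.*-assoc (- sgn d) _ _) ⟩
      (- sgn d) * M zero (suc d) * ∑ (columnTerm (minor M (suc d)))
        ≡⟨ *-distribˡ-∑ ((- sgn d) * M zero (suc d)) (columnTerm (minor M (suc d))) ⟩
      ∑ (λ i → (- sgn d) * M zero (suc d) * columnTerm (minor M (suc d)) i)
        ≡⟨ ∑-cong (λ i → reorder₁ (sgn d) (sgn i) (M zero (suc d)) (M (suc i) zero) (D i d)) ⟩
      ∑ (G d) ∎
      where open ≡-Reasoning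
    columns : ∀ i → columnTerm M (suc i) ≡ ∑ (λ d → G d i)
    columns i = begin
      (- sgn i) * (M (suc i) zero * det (λ r c → M (punchIn (suc i) r) (suc c)))
        ≡⟨ sym (ℤ.*-assoc (- sgn i) _ _) ⟩
      (- sgn i) * M (suc i) zero * det (λ r c → M (punchIn (suc i) r) (suc c))
        ≡⟨ *-distribˡ-∑ ((- sgn i) * M (suc i) zero) (laplaceTerm (λ r c → M (punchIn (suc i) r) (suc c))) ⟩
      ∑ (λ d → (- sgn i) * M (suc i) zero * laplaceTerm (λ r c → M (punchIn (suc i) r) (suc c)) d)
        ≡⟨ ∑-cong (λ d → reorder₂ (sgn d) (sgn i) (M zero (suc d)) (M (suc i) zero) (D i d)) ⟩
      ∑ (λ d → G d i) ∎
      where open ≡-Reasoning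

  det-transpose : (M : Matrix n) → det (transpose M) ≡ det M
  det-transpose {zero}  M = refl
  det-transpose {suc n} M = trans
    (∑-cong λ i → cong (λ d → sgn i * (M i zero * d)) (det-transpose (λ r c → M (punchIn i r) (suc c))))
    (sym (det-column-expansion M))

  det-scale : (c : ℤ) (M : Matrix n) → det (λ i j → c * M i j) ≡ c ^ n * det M
  det-scale {zero}  c M = sym (ℤ.*-identityˡ 1ℤ)
  det-scale {suc n} c M = trans
    (∑-cong λ j → trans (cong (λ d → sgn j * ((c * M zero j) * d)) (det-scale c (minor M j)))
                        (regroup (sgn j) c (M zero j) (c ^ n) (det (minor M j))))
    (sym (*-distribˡ-∑ (c * c ^ n) (laplaceTerm M)))
    where
    regroup : ∀ s c x p d → s * ((c * x) * (p * d)) ≡ (c * p) * (s * (x * d))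
    regroup = solve-∀

  SkewSymmetric : Matrix n → Set
  SkewSymmetric M = ∀ i j → M i j ≡ - M j i

  -1^even : ∀ m → -1ℤ ^ (m ℕ.* 2) ≡ 1ℤ
  -1^even zero    = refl
  -1^even (suc m) = cong (λ x → -1ℤ * (-1ℤ * x)) (-1^even m)

  i≡-i⇒i≡0 : ∀ {i} → i ≡ - i → i ≡ 0ℤ
  i≡-i⇒i≡0 { + zero}  _  = refl
  i≡-i⇒i≡0 { + suc _} ()
  i≡-i⇒i≡0 { -[1+ _ ]} ()

  det-skew-odd : ∀ m (M : Matrix (suc (m ℕ.* 2))) → SkewSymmetric M → det M ≡ 0ℤ
  det-skew-odd m M skew = i≡-i⇒i≡0 (begin
    det M                                    ≡⟨ sym (det-transpose M) ⟩
    det (transpose M)                        ≡⟨ det-cong (λ i j → trans (skew j i) (sym (ℤ.-1*i≡-i (M i j)))) ⟩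
    det (λ i j → -1ℤ * M i j)                ≡⟨ det-scale -1ℤ M ⟩
    -1ℤ * -1ℤ ^ (m ℕ.* 2) * det M            ≡⟨ cong (λ x → -1ℤ * x * det M) (-1^even m) ⟩
    -1ℤ * det M                              ≡⟨ ℤ.-1*i≡-i (det M) ⟩
    - det M ∎)
    where open ≡-Reasoning

  -- Block matrices

  data BlockIndex (k l : ℕ) : Fin (k ℕ.+ l) → Set where
    top    : (a : Fin k) → BlockIndex k l (a ↑ˡ l)
    bottom : (b : Fin l) → BlockIndex k l (k ↑ʳ b)

  blockIndex : ∀ k l (i : Fin (k ℕ.+ l)) → BlockIndex k l i
  blockIndex zero    l i       = bottom i
  blockIndex (suc k) l zero    = top zero
  blockIndex (suc k) l (suc i) with blockIndex k l i
  ... | top a    = top (suc a)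
  ... | bottom b = bottom b

  module _ {X : Set} where

    -- Opaque, so that the blocks can be recovered from an application of blocks by unification.
    opaque
      blocks : (Fin k → Fin k → X) → (Fin k → Fin l → X) →
               (Fin l → Fin k → X) → (Fin l → Fin l → X) →
               Fin (k ℕ.+ l) → Fin (k ℕ.+ l) → X
      blocks A B C D = (λ a → A a ++ B a) ++ (λ c → C c ++ D c)

    module _ {A : Fin k → Fin k → X} {B : Fin k → Fin l → X}
             {C : Fin l → Fin k → X} {D : Fin l → Fin l → X} where

      opaque
        unfolding blocks

        blocks-top : ∀ a → blocks A B C D (a ↑ˡ l) ≡ A a ++ B a
        blocks-top = lookup-++ˡ (λ a → A a ++ B a) (λ c → C c ++ D c)

        blocks-bottom : ∀ c → blocks A B C D (k ↑ʳ c) ≡ C c ++ D c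
        blocks-bottom = lookup-++ʳ (λ a → A a ++ B a) (λ c → C c ++ D c)

      blocks-↑ˡ↑ˡ : ∀ a b → blocks A B C D (a ↑ˡ l) (b ↑ˡ l) ≡ A a b
      blocks-↑ˡ↑ˡ a b = trans (cong-app (blocks-top a) (b ↑ˡ l)) (lookup-++ˡ (A a) (B a) b)

      blocks-↑ˡ↑ʳ : ∀ a b → blocks A B C D (a ↑ˡ l) (k ↑ʳ b) ≡ B a b
      blocks-↑ˡ↑ʳ a b = trans (cong-app (blocks-top a) (k ↑ʳ b)) (lookup-++ʳ (A a) (B a) b)

      blocks-↑ʳ↑ˡ : ∀ c b → blocks A B C D (k ↑ʳ c) (b ↑ˡ l) ≡ C c b
      blocks-↑ʳ↑ˡ c b = trans (cong-app (blocks-bottom c) (b ↑ˡ l)) (lookup-++ˡ (C c) (D c) b)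

      blocks-↑ʳ↑ʳ : ∀ c b → blocks A B C D (k ↑ʳ c) (k ↑ʳ b) ≡ D c b
      blocks-↑ʳ↑ʳ c b = trans (cong-app (blocks-bottom c) (k ↑ʳ b)) (lookup-++ʳ (C c) (D c) b)

  sgn-↑ˡ : (a : Fin k) → sgn (a ↑ˡ l) ≡ sgn a
  sgn-↑ˡ zero    = refl
  sgn-↑ˡ (suc a) = cong -_ (sgn-↑ˡ a)

  punchIn-↑ˡ : (a : Fin (suc k)) (b : Fin k) → punchIn (a ↑ˡ l) (b ↑ˡ l) ≡ punchIn a b ↑ˡ l
  punchIn-↑ˡ zero    b       = refl
  punchIn-↑ˡ (suc a) zero    = refl
  punchIn-↑ˡ (suc a) (suc b) = cong suc (punchIn-↑ˡ a b)

  punchIn-↑ʳ : (a : Fin (suc k)) (b : Fin l) → punchIn (a ↑ˡ l) (k ↑ʳ b) ≡ suc k ↑ʳ b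
  punchIn-↑ʳ         zero    b = refl
  punchIn-↑ʳ {suc k} (suc a) b = cong suc (punchIn-↑ʳ a b)

  minor-blocks : (A : Matrix (suc k)) (B : Fin (suc k) → Fin l → ℤ) (C : Fin l → Fin (suc k) → ℤ)
                 (D : Matrix l) (a : Fin (suc k)) → ∀ i j →
                 minor (blocks A B C D) (a ↑ˡ l) i j ≡
                 blocks (minor A a) (B ∘ suc) (λ c → C c ∘ punchIn a) D i j
  minor-blocks {k} {l} A B C D a i j with blockIndex k l i | blockIndex k l j
  ... | top r    | top e    = trans (cong (blocks A B C D (suc r ↑ˡ l)) (punchIn-↑ˡ a e))
                                    (trans (blocks-↑ˡ↑ˡ (suc r) (punchIn a e)) (sym (blocks-↑ˡ↑ˡ r e)))
  ... | top r    | bottom e = trans (cong (blocks A B C D (suc r ↑ˡ l)) (punchIn-↑ʳ a e))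
                                    (trans (blocks-↑ˡ↑ʳ (suc r) e) (sym (blocks-↑ˡ↑ʳ r e)))
  ... | bottom c | top e    = trans (cong (blocks A B C D (suc k ↑ʳ c)) (punchIn-↑ˡ a e))
                                    (trans (blocks-↑ʳ↑ˡ c (punchIn a e)) (sym (blocks-↑ʳ↑ˡ c e)))
  ... | bottom c | bottom e = trans (cong (blocks A B C D (suc k ↑ʳ c)) (punchIn-↑ʳ a e))
                                    (trans (blocks-↑ʳ↑ʳ c e) (sym (blocks-↑ʳ↑ʳ c e)))

  det-blocks-lower : (A : Matrix k) (B : Fin k → Fin l → ℤ) (C : Fin l → Fin k → ℤ) (D : Matrix l) →
                     (∀ a b → B a b ≡ 0ℤ) → det (blocks A B C D) ≡ det A * det D
  det-blocks-lower {zero}      A B C D B≡0 =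
    trans (det-cong {M = blocks A B C D} {D} (blocks-↑ʳ↑ʳ {k = 0})) (sym (ℤ.*-identityˡ (det D)))
  det-blocks-lower {suc k} {l} A B C D B≡0 = begin
    det M                                                          ≡⟨ ∑-split {suc k} {l} (laplaceTerm M) ⟩
    ∑ (laplaceTerm M ∘ (_↑ˡ l)) + ∑ (laplaceTerm M ∘ (suc k ↑ʳ_))
      ≡⟨ cong₂ _+_ (∑-cong left) (∑-zero right) ⟩
    ∑ (λ a → det D * laplaceTerm A a) + 0ℤ          ≡⟨ ℤ.+-identityʳ _ ⟩
    ∑ (λ a → det D * laplaceTerm A a)               ≡⟨ sym (*-distribˡ-∑ (det D) (laplaceTerm A)) ⟩
    det D * det A                                   ≡⟨ ℤ.*-comm (det D) (det A) ⟩
    det A * det D ∎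
    where
    open ≡-Reasoning
    M = blocks A B C D
    regroup : ∀ s x d e → s * (x * (d * e)) ≡ e * (s * (x * d))
    regroup = solve-∀
    left : ∀ a → laplaceTerm M (a ↑ˡ l) ≡ det D * laplaceTerm A a
    left a = begin
      sgn (a ↑ˡ l) * (M zero (a ↑ˡ l) * det (minor M (a ↑ˡ l)))
        ≡⟨ cong₂ (λ s x → s * (x * det (minor M (a ↑ˡ l)))) (sgn-↑ˡ a) (blocks-↑ˡ↑ˡ zero a) ⟩
      sgn a * (A zero a * det (minor M (a ↑ˡ l)))
        ≡⟨ cong (λ d → sgn a * (A zero a * d))
                (trans (det-cong (minor-blocks A B C D a)) (det-blocks-lower (minor A a) _ _ D (B≡0 ∘ suc))) ⟩
      sgn a * (A zero a * (det (minor A a) * det D))  ≡⟨ regroup (sgn a) (A zero a) (det (minor A a)) (det D) ⟩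
      det D * laplaceTerm A a ∎
    right : ∀ b → laplaceTerm M (suc k ↑ʳ b) ≡ 0ℤ
    right b = begin
      sgn (suc k ↑ʳ b) * (M zero (suc k ↑ʳ b) * det (minor M (suc k ↑ʳ b)))
        ≡⟨ cong (λ x → sgn (suc k ↑ʳ b) * (x * det (minor M (suc k ↑ʳ b))))
                (trans (blocks-↑ˡ↑ʳ zero b) (B≡0 zero b)) ⟩
      sgn (suc k ↑ʳ b) * (0ℤ * det (minor M (suc k ↑ʳ b)))  ≡⟨ ℤ.*-zeroʳ (sgn (suc k ↑ʳ b)) ⟩
      0ℤ ∎

  transpose-blocks : (A : Matrix k) (B : Fin k → Fin l → ℤ) (C : Fin l → Fin k → ℤ) (D : Matrix l) →
                     ∀ i j →
                     transpose (blocks A B C D) i j ≡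
                     blocks (transpose A) (transpose C) (transpose B) (transpose D) i j
  transpose-blocks {k} {l} A B C D i j with blockIndex k l i | blockIndex k l j
  ... | top a    | top b    = trans (blocks-↑ˡ↑ˡ b a) (sym (blocks-↑ˡ↑ˡ a b))
  ... | top a    | bottom b = trans (blocks-↑ʳ↑ˡ b a) (sym (blocks-↑ˡ↑ʳ a b))
  ... | bottom a | top b    = trans (blocks-↑ˡ↑ʳ b a) (sym (blocks-↑ʳ↑ˡ a b))
  ... | bottom a | bottom b = trans (blocks-↑ʳ↑ʳ b a) (sym (blocks-↑ʳ↑ʳ a b))

  det-blocks-upper : (A : Matrix k) (B : Fin k → Fin l → ℤ) (C : Fin l → Fin k → ℤ) (D : Matrix l) →
                     (∀ c a → C c a ≡ 0ℤ) → det (blocks A B C D) ≡ det A * det D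
  det-blocks-upper A B C D C≡0 = begin
    det (blocks A B C D)                   ≡⟨ sym (det-transpose (blocks A B C D)) ⟩
    det (transpose (blocks A B C D))       ≡⟨ det-cong (transpose-blocks A B C D) ⟩
    det (blocks (transpose A) (transpose C) (transpose B) (transpose D))
      ≡⟨ det-blocks-lower (transpose A) (transpose C) (transpose B) (transpose D) (λ a c → C≡0 c a) ⟩
    det (transpose A) * det (transpose D)  ≡⟨ cong₂ _*_ (det-transpose A) (det-transpose D) ⟩
    det A * det D ∎
    where open ≡-Reasoning

  ++-zipWith : {X Y Z : Set} (f : X → Y → Z) (x : Fin k → X) (y : Fin l → X)
               (x′ : Fin k → Y) (y′ : Fin l → Y) →
               ∀ j → f ((x ++ y) j) ((x′ ++ y′) j) ≡
                     ((λ i → f (x i) (x′ i)) ++ (λ i → f (y i) (y′ i))) j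
  ++-zipWith {k} f x y x′ y′ j with splitAt k j
  ... | inj₁ _ = refl
  ... | inj₂ _ = refl

  differences : (Fin (suc n) → Fin k → ℤ) → Fin n → Fin k → ℤ
  differences X a j = X (suc a) j - X zero j

  subtractFirstRow : (Fin (suc n) → Fin k → ℤ) → Fin (suc n) → Fin k → ℤ
  subtractFirstRow X = X zero ∷ differences X

  firstRowCoefficient : Fin (suc n) → ℤ
  firstRowCoefficient = 0ℤ ∷ const -1ℤ

  subtractFirstRow-entry : (X : Fin (suc n) → Fin k → ℤ) → ∀ i j →
                           subtractFirstRow X i j ≡ X i j + firstRowCoefficient i * X zero j
  subtractFirstRow-entry X zero    j = sym (ℤ.+-identityʳ (X zero j))
  subtractFirstRow-entry X (suc a) j = cong (_+_ (X (suc a) j)) (sym (ℤ.-1*i≡-i (X zero j)))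

  det-subtractFirstRow : (X : Matrix (suc n)) → det (subtractFirstRow X) ≡ det X
  det-subtractFirstRow X =
    det-add-pivot-rows {M = X} (const zero) firstRowCoefficient (λ _ → refl) (subtractFirstRow-entry X)

  -- Up to sign, this is the determinant of the odd-order skew-symmetric matrix K = [[0, -1ᵀ], [1, A]]:
  -- subtracting the second row of K from the later ones leaves a single 1 in its first column.
  det-minusOnes∷differences : ∀ m (A : Matrix (suc m ℕ.* 2)) → SkewSymmetric A →
                              det (const -1ℤ ∷ differences A) ≡ 0ℤ
  det-minusOnes∷differences m A A-skew = begin
    det X                    ≡⟨ sym (ℤ.neg-involutive (det X)) ⟩
    - - det X                ≡⟨ cong -_ (sym det-K′) ⟩
    - det K′
      ≡⟨ cong -_ (det-add-pivot-rows {M = K} (const (suc zero)) (0ℤ ∷ firstRowCoefficient) (λ _ → refl) K′-entry) ⟩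
    - det K                  ≡⟨ cong -_ (det-skew-odd (suc m) K K-skew) ⟩
    - 0ℤ ∎
    where
    open ≡-Reasoning
    X : Matrix (suc m ℕ.* 2)
    X = const -1ℤ ∷ differences A
    K K′ : Matrix (suc (suc m ℕ.* 2))
    K  = (0ℤ ∷ const -1ℤ) ∷ (λ a → 1ℤ ∷ A a)
    K′ = K zero ∷ subtractFirstRow (λ a → 1ℤ ∷ A a)
    K-skew : SkewSymmetric K
    K-skew zero    zero    = refl
    K-skew zero    (suc b) = refl
    K-skew (suc a) zero    = refl
    K-skew (suc a) (suc b) = A-skew a b
    K′-entry : ∀ i j → K′ i j ≡ K i j + (0ℤ ∷ firstRowCoefficient) i * K (suc zero) j
    K′-entry zero    j = sym (ℤ.+-identityʳ (K zero j))
    K′-entry (suc a) j = subtractFirstRow-entry (λ a → 1ℤ ∷ A a) a j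
    det-K′ : det K′ ≡ - det X
    det-K′ = begin
      det K′
        ≡⟨ det-column-expansion K′ ⟩
      columnTerm K′ zero + (columnTerm K′ (suc zero) + ∑ (λ a → columnTerm K′ (suc (suc a))))
        ≡⟨ cong (_+_ (columnTerm K′ zero) ∘ _+_ (columnTerm K′ (suc zero)))
                (∑-zero {f = λ a → columnTerm K′ (suc (suc a))} λ a → ℤ.*-zeroʳ (sgn (suc (suc a)))) ⟩
      columnTerm K′ zero + (columnTerm K′ (suc zero) + 0ℤ)
        ≡⟨ simplify (det (λ r c → K′ (suc r) (suc c))) (det (λ r c → K′ (punchIn (suc zero) r) (suc c))) ⟩
      - det (λ r c → K′ (punchIn (suc zero) r) (suc c))
        ≡⟨ cong -_ (det-cong X-entry) ⟩
      - det X ∎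
      where
      X-entry : ∀ r c → K′ (punchIn (suc zero) r) (suc c) ≡ X r c
      X-entry zero    c = refl
      X-entry (suc r) c = refl
      simplify : ∀ d e → 1ℤ * (0ℤ * d) + (-1ℤ * (1ℤ * e) + 0ℤ) ≡ - e
      simplify = solve-∀

  module FirstRows {k l : ℕ} (As : Fin k → Fin (suc k) → ℤ) (Bs : Fin k → Fin (suc l) → ℤ)
                   (Cs : Fin l → Fin (suc k) → ℤ) (Ds : Fin l → Fin (suc l) → ℤ) where

    withFirstRows : (Fin (suc k) → ℤ) → (Fin (suc l) → ℤ) → (Fin (suc k) → ℤ) → (Fin (suc l) → ℤ) →
                    Matrix (suc k ℕ.+ suc l)
    withFirstRows a b c d = blocks (a ∷ As) (b ∷ Bs) (c ∷ Cs) (d ∷ Ds)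

    b₀ : Fin (suc k ℕ.+ suc l)
    b₀ = suc k ↑ʳ zero

    top-row : ∀ a b c d → withFirstRows a b c d zero ≡ a ++ b
    top-row a b c d = blocks-top zero

    bottom-row : ∀ a b c d → withFirstRows a b c d b₀ ≡ c ++ d
    bottom-row a b c d = blocks-bottom zero

    same-other-rows : ∀ {a b c d a′ b′ c′ d′} i → i ≢ zero → i ≢ b₀ →
                      withFirstRows a b c d i ≡ withFirstRows a′ b′ c′ d′ i
    same-other-rows i i≢t₀ i≢b₀ with blockIndex (suc k) (suc l) i
    ... | top zero       = ⊥-elim (i≢t₀ refl)
    ... | top (suc r)    = trans (blocks-top (suc r)) (sym (blocks-top (suc r)))
    ... | bottom zero    = ⊥-elim (i≢b₀ refl)
    ... | bottom (suc r) = trans (blocks-bottom (suc r)) (sym (blocks-bottom (suc r)))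

    private
      pointwise-+ : ∀ {p} (x x₁ x₂ : Fin p → ℤ) → Set
      pointwise-+ x x₁ x₂ = ∀ j → x j ≡ x₁ j + x₂ j

    det-top-additive : ∀ {a a₁ a₂ b b₁ b₂} c d → pointwise-+ a a₁ a₂ → pointwise-+ b b₁ b₂ →
                   det (withFirstRows a b c d) ≡ det (withFirstRows a₁ b₁ c d) + det (withFirstRows a₂ b₂ c d)
    det-top-additive {a} {a₁} {a₂} {b} {b₁} {b₂} c d a≡ b≡ = det-row-additive zero same same λ j → begin
      withFirstRows a b c d zero j                ≡⟨ cong-app (top-row a b c d) j ⟩
      (a ++ b) j                                  ≡⟨ ++-cong a _ a≡ b≡ j ⟩
      ((λ i → a₁ i + a₂ i) ++ (λ i → b₁ i + b₂ i)) j  ≡⟨ sym (++-zipWith _+_ a₁ b₁ a₂ b₂ j) ⟩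
      (a₁ ++ b₁) j + (a₂ ++ b₂) j
        ≡⟨ sym (cong₂ _+_ (cong-app (top-row a₁ b₁ c d) j) (cong-app (top-row a₂ b₂ c d) j)) ⟩
      withFirstRows a₁ b₁ c d zero j + withFirstRows a₂ b₂ c d zero j ∎
      where
      open ≡-Reasoning
      same : ∀ {a′ b′} → SameRowsExcept zero (withFirstRows a′ b′ c d) (withFirstRows a b c d)
      same {a′} {b′} i i≢t₀ with i ≟ b₀
      ... | yes refl = cong-app (trans (bottom-row a′ b′ c d) (sym (bottom-row a b c d)))
      ... | no i≢b₀  = cong-app (same-other-rows i i≢t₀ i≢b₀)

    det-bottom-additive : ∀ {c c₁ c₂ d d₁ d₂} a b → pointwise-+ c c₁ c₂ → pointwise-+ d d₁ d₂ →
                      det (withFirstRows a b c d) ≡ det (withFirstRows a b c₁ d₁) + det (withFirstRows a b c₂ d₂)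
    det-bottom-additive {c} {c₁} {c₂} {d} {d₁} {d₂} a b c≡ d≡ = det-row-additive b₀ same same λ j → begin
      withFirstRows a b c d b₀ j                  ≡⟨ cong-app (bottom-row a b c d) j ⟩
      (c ++ d) j                                  ≡⟨ ++-cong c _ c≡ d≡ j ⟩
      ((λ i → c₁ i + c₂ i) ++ (λ i → d₁ i + d₂ i)) j  ≡⟨ sym (++-zipWith _+_ c₁ d₁ c₂ d₂ j) ⟩
      (c₁ ++ d₁) j + (c₂ ++ d₂) j
        ≡⟨ sym (cong₂ _+_ (cong-app (bottom-row a b c₁ d₁) j) (cong-app (bottom-row a b c₂ d₂) j)) ⟩
      withFirstRows a b c₁ d₁ b₀ j + withFirstRows a b c₂ d₂ b₀ j ∎
      where
      open ≡-Reasoning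
      same : ∀ {c′ d′} → SameRowsExcept b₀ (withFirstRows a b c′ d′) (withFirstRows a b c d)
      same {c′} {d′} i i≢b₀ with i ≟ zero
      ... | yes refl = cong-app (trans (top-row a b c′ d′) (sym (top-row a b c d)))
      ... | no i≢t₀  = cong-app (same-other-rows i i≢t₀ i≢b₀)

    det-swap-first-rows : ∀ a b c d → det (withFirstRows c d a b) ≡ - det (withFirstRows a b c d)
    det-swap-first-rows a b c d =
      det-swap-rows (det-alternating _) {withFirstRows a b c d} {withFirstRows c d a b} {zero} {b₀} (λ ())
      (cong-app (trans (top-row c d a b) (sym (bottom-row a b c d))))
      (cong-app (trans (bottom-row c d a b) (sym (top-row a b c d))))
      λ i i≢t₀ i≢b₀ → cong-app (same-other-rows i i≢t₀ i≢b₀)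

  ++-row-operation : (s : ℤ) {x x₀ x′ : Fin k → ℤ} {y y₀ y′ : Fin l → ℤ} →
                     (∀ j → x′ j ≡ x j + s * x₀ j) → (∀ j → y′ j ≡ y j + s * y₀ j) →
                     ∀ j → (x′ ++ y′) j ≡ (x ++ y) j + s * (x₀ ++ y₀) j
  ++-row-operation s {x} {x₀} {x′} {y} {y₀} x′≡ y′≡ j =
    trans (++-cong x′ _ x′≡ y′≡ j) (sym (++-zipWith (λ u v → u + s * v) x y x₀ y₀ j))

  det-blocks-subtractFirstRow :
    (A : Matrix (suc k)) (B : Fin (suc k) → Fin (suc l) → ℤ)
    (C : Fin (suc l) → Fin (suc k) → ℤ) (D : Matrix (suc l)) →
    det (blocks (subtractFirstRow A) (subtractFirstRow B) (subtractFirstRow C) (subtractFirstRow D)) ≡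
    det (blocks A B C D)
  det-blocks-subtractFirstRow {k} {l} A B C D = det-add-pivot-rows {M = M} π c pivots-fixed entry
    where
    M : Matrix (suc k ℕ.+ suc l)
    M = blocks A B C D
    b₀ : Fin (suc k ℕ.+ suc l)
    b₀ = suc k ↑ʳ zero
    π : Fin (suc k ℕ.+ suc l) → Fin (suc k ℕ.+ suc l)
    π = const {B = Fin (suc k)} zero ++ const b₀
    c : Fin (suc k ℕ.+ suc l) → ℤ
    c = firstRowCoefficient {k} ++ firstRowCoefficient {l}
    π-top : ∀ a → π (a ↑ˡ suc l) ≡ zero
    π-top = lookup-++ˡ (const {B = Fin (suc k)} zero) (const b₀)
    π-bottom : ∀ b → π (suc k ↑ʳ b) ≡ b₀
    π-bottom = lookup-++ʳ (const {B = Fin (suc k)} zero) (const b₀)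
    c-top : ∀ a → c (a ↑ˡ suc l) ≡ firstRowCoefficient a
    c-top = lookup-++ˡ firstRowCoefficient (firstRowCoefficient {l})
    c-bottom : ∀ b → c (suc k ↑ʳ b) ≡ firstRowCoefficient b
    c-bottom = lookup-++ʳ (firstRowCoefficient {k}) firstRowCoefficient
    pivots-fixed : ∀ i → c (π i) ≡ 0ℤ
    pivots-fixed i with blockIndex (suc k) (suc l) i
    ... | top a    = trans (cong c (π-top a)) (c-top zero)
    ... | bottom b = trans (cong c (π-bottom b)) (c-bottom zero)
    operated-entry : ∀ {i s} {r r₀ : Fin (suc k ℕ.+ suc l) → ℤ} → M i ≡ r → c i ≡ s → M (π i) ≡ r₀ →
                     ∀ j → r j + s * r₀ j ≡ M i j + c i * M (π i) j
    operated-entry refl refl refl j = refl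
    entry : ∀ i j → blocks (subtractFirstRow A) (subtractFirstRow B) (subtractFirstRow C) (subtractFirstRow D) i j ≡
                    M i j + c i * M (π i) j
    entry i j with blockIndex (suc k) (suc l) i
    ... | top a = trans (cong-app (blocks-top a) j)
      (trans (++-row-operation (firstRowCoefficient a) (subtractFirstRow-entry A a) (subtractFirstRow-entry B a) j)
             (operated-entry (blocks-top a) (c-top a) (trans (cong M (π-top a)) (blocks-top zero)) j))
    ... | bottom b = trans (cong-app (blocks-bottom b) j)
      (trans (++-row-operation (firstRowCoefficient b) (subtractFirstRow-entry C b) (subtractFirstRow-entry D b) j)
             (operated-entry (blocks-bottom b) (c-bottom b) (trans (cong M (π-bottom b)) (blocks-bottom zero)) j))

  joinedByOnes : Matrix k → Matrix l → Matrix (k ℕ.+ l)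
  joinedByOnes A B = blocks A (λ _ _ → 1ℤ) (λ _ _ → -1ℤ) B

  det-joinedByOnes : ∀ m (A : Matrix (suc m ℕ.* 2)) (B : Matrix (suc l)) → SkewSymmetric A →
                     det (joinedByOnes A B) ≡ det A * det B
  det-joinedByOnes {l} m A B A-skew = begin
    det (joinedByOnes A B)
      ≡⟨ sym (det-blocks-subtractFirstRow A (λ _ _ → 1ℤ) (λ _ _ → -1ℤ) B) ⟩
    det (withFirstRows (A zero) 1s -1s (B zero))
      ≡⟨ det-bottom-additive (A zero) 1s (λ _ → refl) (λ j → sym (ℤ.+-identityʳ (B zero j))) ⟩
    det (withFirstRows (A zero) 1s 0s (B zero)) + det (withFirstRows (A zero) 1s -1s 0s)
      ≡⟨ cong₂ _+_ decoupled coupled ⟩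
    det A * det B + 0ℤ                              ≡⟨ ℤ.+-identityʳ (det A * det B) ⟩
    det A * det B ∎
    where
    open ≡-Reasoning
    open FirstRows {suc (m ℕ.* 2)} {l} (differences A) (λ _ _ → 0ℤ) (λ _ _ → 0ℤ) (differences B)
    0s 1s -1s : ∀ {p} → Fin p → ℤ
    0s  = const 0ℤ
    1s  = const 1ℤ
    -1s = const -1ℤ
    zero-block : ∀ {p q} (a : Fin (suc p)) (b : Fin q) → (0s ∷ λ _ _ → 0ℤ) a b ≡ 0ℤ
    zero-block zero    b = refl
    zero-block (suc a) b = refl
    decoupled : det (withFirstRows (A zero) 1s 0s (B zero)) ≡ det A * det B
    decoupled = trans (det-blocks-upper (subtractFirstRow A) _ _ (subtractFirstRow B) zero-block)
                      (cong₂ _*_ (det-subtractFirstRow A) (det-subtractFirstRow B))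
    coupled : det (withFirstRows (A zero) 1s -1s 0s) ≡ 0ℤ
    coupled = begin
      det (withFirstRows (A zero) 1s -1s 0s)
        ≡⟨ det-top-additive -1s 0s (λ j → sym (ℤ.+-identityʳ (A zero j))) (λ _ → refl) ⟩
      det (withFirstRows (A zero) 0s -1s 0s) + det (withFirstRows 0s 1s -1s 0s)
        ≡⟨ cong (_+_ (det (withFirstRows (A zero) 0s -1s 0s))) (det-swap-first-rows -1s 0s 0s 1s) ⟩
      det (withFirstRows (A zero) 0s -1s 0s) + - det (withFirstRows -1s 0s 0s 1s)
        ≡⟨ cong₂ (λ x y → x + - y) (det-blocks-lower (subtractFirstRow A) _ _ (0s ∷ differences B) zero-block)
                                   (det-blocks-lower (-1s ∷ differences A) _ _ (1s ∷ differences B) zero-block) ⟩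
      det (subtractFirstRow A) * det (0s ∷ differences B) + - (det (-1s ∷ differences A) * det (1s ∷ differences B))
        ≡⟨ cong₂ (λ x y → det (subtractFirstRow A) * x + - (y * det (1s ∷ differences B)))
                 (det-zero-row (0s ∷ differences B) zero (λ _ → refl)) (det-minusOnes∷differences m A A-skew) ⟩
      det (subtractFirstRow A) * 0ℤ + - (0ℤ * det (1s ∷ differences B))
        ≡⟨ vanish (det (subtractFirstRow A)) (det (1s ∷ differences B)) ⟩
      0ℤ ∎
      where
      vanish : ∀ x y → x * 0ℤ + - (0ℤ * y) ≡ 0ℤ
      vanish = solve-∀

module Tournaments where

  open import Data.Integer.Base using (_+_; _*_)
  open Determinant

  ↑ˡ≢↑ʳ : (a : Fin k) (b : Fin l) → a ↑ˡ l ≢ k ↑ʳ b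
  ↑ˡ≢↑ʳ zero    b ()
  ↑ˡ≢↑ʳ (suc a) b eq = ↑ˡ≢↑ʳ a b (suc-injective eq)

  seidel-diagonal : (T : Tournament n) (i : Fin n) → seidel T i i ≡ 0ℤ
  seidel-diagonal T i with i ≟ i
  ... | yes _   = refl
  ... | no  i≢i = ⊥-elim (i≢i refl)

  arcSign : Bool → ℤ
  arcSign x = if x then 1ℤ else -1ℤ

  seidel-off-diagonal : (T : Tournament n) {i j : Fin n} → i ≢ j → seidel T i j ≡ arcSign (arc T i j)
  seidel-off-diagonal T {i} {j} i≢j with i ≟ j
  ... | yes i≡j = ⊥-elim (i≢j i≡j)
  ... | no  _   = refl

  seidel-skew : (T : Tournament n) → SkewSymmetric (seidel T)
  seidel-skew T i j = by-cases (i ≟ j)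
    where
    opposite : ∀ {x y} → x ≢ y → arcSign x ≡ - arcSign y
    opposite {true}  {true}  x≢y = ⊥-elim (x≢y refl)
    opposite {true}  {false} _   = refl
    opposite {false} {true}  _   = refl
    opposite {false} {false} x≢y = ⊥-elim (x≢y refl)
    by-cases : Dec (i ≡ j) → seidel T i j ≡ - seidel T j i
    by-cases (yes refl) = trans (seidel-diagonal T i) (cong -_ (sym (seidel-diagonal T i)))
    by-cases (no i≢j)   = trans (seidel-off-diagonal T i≢j)
      (trans (opposite (exactlyOne T i j i≢j)) (cong -_ (sym (seidel-off-diagonal T (i≢j ∘ sym)))))

  seidel-embedding : (T : Tournament n) (T′ : Tournament k) (f : Fin n → Fin k) →
                     (∀ {i j} → f i ≡ f j → i ≡ j) → (∀ i j → arc T′ (f i) (f j) ≡ arc T i j) →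
                     ∀ i j → seidel T′ (f i) (f j) ≡ seidel T i j
  seidel-embedding T T′ f f-injective arcs i j = by-cases (i ≟ j)
    where
    by-cases : Dec (i ≡ j) → seidel T′ (f i) (f j) ≡ seidel T i j
    by-cases (yes refl) = trans (seidel-diagonal T′ (f i)) (sym (seidel-diagonal T i))
    by-cases (no i≢j)   = trans (seidel-off-diagonal T′ (i≢j ∘ f-injective))
      (trans (cong arcSign (arcs i j)) (sym (seidel-off-diagonal T i≢j)))

  _⇒_ : Tournament k → Tournament l → Tournament (k ℕ.+ l)
  _⇒_ {k} {l} S T = record
    { arc        = arcs
    ; loopless   = loopless′
    ; exactlyOne = exactlyOne′
    }
    where
    arcs : Fin (k ℕ.+ l) → Fin (k ℕ.+ l) → Bool
    arcs = blocks (arc S) (λ _ _ → true) (λ _ _ → false) (arc T)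
    loopless′ : ∀ i → arcs i i ≡ false
    loopless′ i with blockIndex k l i
    ... | top a    = trans (blocks-↑ˡ↑ˡ a a) (loopless S a)
    ... | bottom b = trans (blocks-↑ʳ↑ʳ b b) (loopless T b)
    true≢false : true ≢ false
    true≢false ()
    exactlyOne′ : ∀ i j → i ≢ j → arcs i j ≢ arcs j i
    exactlyOne′ i j i≢j with blockIndex k l i | blockIndex k l j
    ... | top a    | top b    = λ eq → exactlyOne S a b (i≢j ∘ cong (_↑ˡ l))
                                         (trans (sym (blocks-↑ˡ↑ˡ a b)) (trans eq (blocks-↑ˡ↑ˡ b a)))
    ... | top a    | bottom b = λ eq →
      true≢false (trans (sym (blocks-↑ˡ↑ʳ a b)) (trans eq (blocks-↑ʳ↑ˡ b a)))
    ... | bottom a | top b    = λ eq →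
      true≢false (trans (sym (blocks-↑ˡ↑ʳ b a)) (trans (sym eq) (blocks-↑ʳ↑ˡ a b)))
    ... | bottom a | bottom b = λ eq → exactlyOne T a b (i≢j ∘ cong (k ↑ʳ_))
                                         (trans (sym (blocks-↑ʳ↑ʳ a b)) (trans eq (blocks-↑ʳ↑ʳ b a)))

  seidel-⇒ : (S : Tournament k) (T : Tournament l) → ∀ i j →
             seidel (S ⇒ T) i j ≡ joinedByOnes (seidel S) (seidel T) i j
  seidel-⇒ {k} {l} S T i j with blockIndex k l i | blockIndex k l j
  ... | top a    | top b    = trans (seidel-embedding S (S ⇒ T) (_↑ˡ l) (↑ˡ-injective l _ _) blocks-↑ˡ↑ˡ a b)
                                    (sym (blocks-↑ˡ↑ˡ a b))
  ... | top a    | bottom b = trans (seidel-off-diagonal (S ⇒ T) (↑ˡ≢↑ʳ a b))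
                                    (trans (cong arcSign (blocks-↑ˡ↑ʳ a b)) (sym (blocks-↑ˡ↑ʳ a b)))
  ... | bottom a | top b    = trans (seidel-off-diagonal (S ⇒ T) (↑ˡ≢↑ʳ b a ∘ sym))
                                    (trans (cong arcSign (blocks-↑ʳ↑ˡ a b)) (sym (blocks-↑ʳ↑ˡ a b)))
  ... | bottom a | bottom b = trans (seidel-embedding T (S ⇒ T) (k ↑ʳ_) (↑ʳ-injective k _ _) blocks-↑ʳ↑ʳ a b)
                                    (sym (blocks-↑ʳ↑ʳ a b))

  InD-product : ∀ m {l a b} → InD (suc m ℕ.* 2) a → InD (suc l) b → InD (suc m ℕ.* 2 ℕ.+ suc l) (a ℕ.* b)
  InD-product m {l} {a} {b} (S , det-S) (T , det-T) = S ⇒ T , (begin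
    det (seidel (S ⇒ T))                      ≡⟨ det-cong (seidel-⇒ S T) ⟩
    det (joinedByOnes (seidel S) (seidel T))  ≡⟨ det-joinedByOnes m (seidel S) (seidel T) (seidel-skew S) ⟩
    det (seidel S) * det (seidel T)           ≡⟨ cong₂ _*_ det-S det-T ⟩
    + (a ℕ.* a) * + (b ℕ.* b)                 ≡⟨ sym (ℤ.pos-* (a ℕ.* a) (b ℕ.* b)) ⟩
    + (a ℕ.* a ℕ.* (b ℕ.* b))                 ≡⟨ cong +_ (ℕₚ.[m*n]*[o*p]≡[m*o]*[n*p] a a b b) ⟩
    + (a ℕ.* b ℕ.* (a ℕ.* b)) ∎)
    where open ≡-Reasoning

  InD-2-1 : InD 2 1
  InD-2-1 = record { arc = arc₂ ; loopless = loopless₂ ; exactlyOne = exactlyOne₂ } , refl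
    where
    arc₂ : Fin 2 → Fin 2 → Bool
    arc₂ zero (suc zero) = true
    arc₂ _    _          = false
    loopless₂ : ∀ i → arc₂ i i ≡ false
    loopless₂ zero       = refl
    loopless₂ (suc zero) = refl
    exactlyOne₂ : ∀ i j → i ≢ j → arc₂ i j ≢ arc₂ j i
    exactlyOne₂ zero       zero       0≢0 = ⊥-elim (0≢0 refl)
    exactlyOne₂ zero       (suc zero) _   ()
    exactlyOne₂ (suc zero) zero       _   ()
    exactlyOne₂ (suc zero) (suc zero) 1≢1 = ⊥-elim (1≢1 refl)

open Tournaments using (InD-product; InD-2-1)
open import Data.Nat using (ℕ; _+_; _*_; _≤_; s≤s; z≤n)
open import Data.Nat.Divisibility using (_∣_; divides)
open import Data.Product using (_×_)

products-closed : (k ℓ : ℕ) → 2 ∣ k → 2 ∣ ℓ → 1 ≤ k → 1 ≤ ℓ →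
                  (a b : ℕ) → InD k a → InD ℓ b → InD (k + ℓ) (a * b)
products-closed _ zero    _                      _ _  ()
products-closed _ (suc l) (divides zero    refl) _ () _
products-closed _ (suc l) (divides (suc m) refl) _ _  _ a b = InD-product m {l} {a} {b}

corollary2p3 : ((k ℓ : ℕ) → 2 ∣ k → 2 ∣ ℓ → 1 ≤ k → 1 ≤ ℓ →
                  (a b : ℕ) → InD k a → InD ℓ b → InD (k + ℓ) (a * b))
               × ((n : ℕ) → 2 ∣ n → 1 ≤ n → (a : ℕ) → InD n a → InD (n + 2) a)
corollary2p3 = products-closed , λ n 2∣n 1≤n a n∋a →
  subst (InD (n + 2)) (ℕₚ.*-identityʳ a)
        (products-closed n 2 2∣n (divides 1 refl) 1≤n (s≤s z≤n) a 1 n∋a InD-2-1)
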